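{- The map $K$ from the set of diversified elements of $\mathbf{S}$ to FTP is onto: for every $\langle R,X\rangle\in$ FTP there is a diversified $\mathbf{S}$-term $t$ with $\kappa(t)=\langle R,X\rangle$.
   Context: A relation is a pair $\langle R,X\rangle$ with $R\subseteq X^2$; $X$ is its domain. For relations $\langle R,X\rangle,\langle S,Y\rangle$ with $X\cap Y=\emptyset$ define $\langle R,X\rangle+\langle S,Y\rangle=\langle R\cup S,X\cup Y\rangle$ and $\langle R,X\rangle\cdot\langle S,Y\rangle=\langle R\cup S\cup(X\times Y),X\cup Y\rangle$. Partial orders are strict (irreflexive and transitive). A relation $\langle R,X\rangle$ is trifunctional if for all $x,y,z,u\in X$: if $(x,z),(y,z),(y,u)\in R$ then $(x,u)\in R$ or $(y,x)\in R$ or $(u,z)\in R$. Fix an infinite set of variables ($\mathbf{S}$-variables). $\mathbf{S}$-terms are built from $\mathbf{S}$-variables with binary operations $+$ and $\cdot$. Let $\equiv$ be the least congruence on $\mathbf{S}$-terms making $+$ associative and commutative and $\cdot$ associative; $[t]$ is the $\equiv$-class of $t$, and $\mathbf{S}$ consists of these classes. An $\mathbf{S}$-term is diversified if no $\mathbf{S}$-variable occurs in it more than once; $[t]$ is diversified if $t$ is. FTP is the set of trifunctional partial orders $\langle R,X\rangle$ with $X$ a nonempty finite set of $\mathbf{S}$-variables. For diversified $t$ define $\kappa(x)=\langle\emptyset,\{x\}\rangle$, $\kappa(t+s)=\kappa(t)+\kappa(s)$, $\kappa(t\cdot s)=\kappa(t)\cdot\kappa(s)$; this induces $K[t]=\kappa(t)$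 on diversified elements of $\mathbf{S}$. -}

module Defs where

open import Data.Nat using (ℕ)
open import Data.Product using (_×_; _,_; ∃)
open import Data.Sum using (_⊎_)
open import Data.Empty using (⊥)
open import Data.List using (List; []; _∷_; _++_)
open import Data.List.Membership.Propositional using (_∈_)
open import Data.List.Relation.Unary.All using (All)
open import Data.List.Relation.Unary.Unique.Propositional using (Unique)
open import Function.Bundles using (_⇔_)

Var : Set
Var = ℕ

data Term : Set where
  var  : Var → Term
  _⊕_  : Term → Term → Term
  _⊙_  : Term → Term → Term

vars : Term → List Var
vars (var x) = x ∷ []
vars (t ⊕ s) = vars t ++ vars s
vars (t ⊙ s) = vars t ++ vars s

Diversified : Term → Set
Diversified t = Unique (vars t)

-- κ(t) = ⟨κRel t , vars t⟩  (domain = set of variables of t)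
κRel : Term → Var → Var → Set
κRel (var x) a b = ⊥
κRel (t ⊕ s) a b = κRel t a b ⊎ κRel s a b
κRel (t ⊙ s) a b = κRel t a b ⊎ (κRel s a b ⊎ (a ∈ vars t × b ∈ vars s))

-- A finite relation ⟨R , X⟩ on variables: X a finite set (list, read as a set),
-- R a finite set of pairs (list, read as a set).
record FinRel : Set where
  constructor ⟨_,_⟩
  field
    R : List (Var × Var)
    X : List Var

open FinRel public

_~[_]_ : Var → FinRel → Var → Set
a ~[ ρ ] b = (a , b) ∈ R ρ

record InFTP (ρ : FinRel) : Set where
  field
    relOn       : ∀ a b → a ~[ ρ ] b → a ∈ X ρ × b ∈ X ρ
    nonempty    : ∃ λ x → x ∈ X ρ
    irreflexive : ∀ x → x ~[ ρ ] x → ⊥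
    transitive  : ∀ x y z → x ~[ ρ ] y → y ~[ ρ ] z → x ~[ ρ ] z
    trifunctional : ∀ x y z u → x ∈ X ρ → y ∈ X ρ → z ∈ X ρ → u ∈ X ρ →
      x ~[ ρ ] z → y ~[ ρ ] z → y ~[ ρ ] u →
      (x ~[ ρ ] u) ⊎ ((y ~[ ρ ] x) ⊎ (u ~[ ρ ] z))

κ≡ : Term → FinRel → Set
κ≡ t ρ = (∀ x → (x ∈ vars t) ⇔ (x ∈ X ρ)) × (∀ a b → κRel t a b ⇔ (a ~[ ρ ] b))

-- The heart of the proof is a splitting lemma: a finite set Y carrying a
-- trifunctional strict order, with at least two elements, can be cut into two
-- nonempty blocks that are either *parallel* (no element of one block is
-- related to an element of the other) or in *series* (the first block lies
-- entirely below the second).  It is proved by induction on |Y|, removing a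
-- maximal element m: depending on how the elements below m relate to the
-- elements incomparable with m, either a split of Y can be read off directly,
-- or a split of Y ∖ m is extended by putting m into a suitable block, the
-- choice being justified by trifunctionality.
--
-- Module Decomposition then builds the term by recursion along
-- splits: a singleton is a variable, a parallel split a sum, a series split a
-- product.
module Submission where

open import Defs
open import Data.Bool using (Bool; true; false; not; if_then_else_) renaming (_≟_ to _≟ᵇ_)
open import Data.Bool.Properties using (¬-not; not-¬)
open import Data.List using (List; []; _∷_; _++_; length; filter)
open import Data.List.Properties using (filter-notAll)
open import Data.List.Membership.Propositional using (_∈_; find; lose)
open import Data.List.Membership.Propositional.Properties using (∈-filter⁺; ∈-filter⁻; ∈-++⁺ˡ; ∈-++⁺ʳ; ∈-++⁻)
import Data.List.Membership.DecPropositional as DecMembership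
open import Data.List.Relation.Unary.Any using (here; there; any?)
open import Data.List.Relation.Unary.All using ([])
open import Data.List.Relation.Unary.AllPairs using ([]; _∷_)
open import Data.List.Relation.Unary.Unique.Propositional.Properties using (++⁺)
open import Data.Nat using (zero; suc; _≤_; _<_) renaming (_≟_ to _≟ℕ_)
open import Data.Nat.Properties using (≤-refl; <-≤-trans; ≤-pred)
open import Data.Product using (_×_; _,_; -,_; ∃; ∃₂; proj₁; proj₂)
open import Data.Product.Properties using (≡-dec)
open import Data.Sum using (_⊎_; inj₁; inj₂)
open import Function using (_∘_)
open import Function.Bundles using (_⇔_; mk⇔; Equivalence)
open import Relation.Binary.Definitions using (DecidableEquality)
open import Relation.Binary.PropositionalEquality using (_≡_; _≢_; refl; sym; trans; subst; subst₂)
open import Relation.Nullary using (¬_; Dec; yes; no; does; ¬?; _×-dec_; contradiction)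
open import Relation.Nullary.Decidable using (dec-true; dec-false; decidable-stable)

Trifunctional : {A : Set} → (A → A → Set) → Set
Trifunctional _≺_ = ∀ {x y z u} → x ≺ z → y ≺ z → y ≺ u → x ≺ u ⊎ y ≺ x ⊎ u ≺ z

search : {A : Set} {P : A → Set} → (∀ x → Dec (P x)) → (Y : List A) →
         (∃ λ x → x ∈ Y × P x) ⊎ (∀ {x} → x ∈ Y → ¬ P x)
search P? Y with any? P? Y
... | yes found = inj₁ (find found)
... | no none   = inj₂ λ x∈ px → none (lose x∈ px)

searchPairs : {A : Set} {P : A → A → Set} → (∀ x y → Dec (P x y)) → (Y : List A) →
              (∃₂ λ x y → x ∈ Y × y ∈ Y × P x y) ⊎ (∀ {x y} → x ∈ Y → y ∈ Y → ¬ P x y)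
searchPairs P? Y with search (λ x → any? (P? x) Y) Y
... | inj₁ (x , x∈ , found) = let y , y∈ , pxy = find found in inj₁ (x , y , x∈ , y∈ , pxy)
... | inj₂ none            = inj₂ λ x∈ y∈ pxy → none x∈ (lose y∈ pxy)

holds : {P : Set} (d : Dec P) → does d ≡ true → P
holds (yes p) _ = p
holds (no _) ()

fails : {P : Set} (d : Dec P) → does d ≡ false → ¬ P
fails (yes _) ()
fails (no ¬p) _ = ¬p

-- Fuel for recursion along strictly shorter lists: length k < l ≤ n + 1 leaves k ≤ n.
shorter : ∀ {k l n} → k < l → l ≤ suc n → k ≤ n
shorter k<l l≤ = ≤-pred (<-≤-trans k<l l≤)

module Splitting {A : Set} (_≟_ : DecidableEquality A)
                 {_≺_ : A → A → Set} (_≺?_ : ∀ x y → Dec (x ≺ y))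
                 (irrefl : ∀ {x} → ¬ x ≺ x)
                 (≺-trans : ∀ {x y z} → x ≺ y → y ≺ z → x ≺ z)
                 (trifun : Trifunctional _≺_) where

  ≺⇒≢ : ∀ {x y} → x ≺ y → x ≢ y
  ≺⇒≢ x≺y refl = irrefl x≺y

  Maximal : List A → A → Set
  Maximal Y m = ∀ {z} → z ∈ Y → ¬ m ≺ z

  maximal : (y : A) (ys : List A) → ∃ λ m → m ∈ y ∷ ys × Maximal (y ∷ ys) m
  maximal y [] = y , here refl , λ { (here refl) → irrefl }
  maximal y (z ∷ zs) with maximal z zs
  ... | m , m∈ , m-max with m ≺? y
  ...   | yes m≺y = y , here refl , λ { (here refl) → irrefl ; (there w∈) y≺w → m-max w∈ (≺-trans m≺y y≺w) }
  ...   | no m⊀y  = m , there m∈ , λ { (here refl) → m⊀y ; (there w∈) → m-max w∈ }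

  record Bipartition (Y : List A) : Set where
    constructor bipartition
    field
      block     : A → Bool
      inhabited : ∀ s → ∃ λ a → a ∈ Y × block a ≡ s
  open Bipartition public

  Parallel : (Y : List A) → Bipartition Y → Set
  Parallel Y β = ∀ {a b} → a ∈ Y → b ∈ Y → block β a ≢ block β b → ¬ a ≺ b

  Series : (Y : List A) → Bipartition Y → Set
  Series Y β = ∀ {a b} → a ∈ Y → b ∈ Y → block β a ≡ true → block β b ≡ false → a ≺ b

  data Split (Y : List A) : Set where
    parallel : (β : Bipartition Y) → Parallel Y β → Split Y
    series   : (β : Bipartition Y) → Series Y β → Split Y

  module Cut {Y : List A} {P : A → Set} (P? : ∀ x → Dec (P x))
             (some : ∃ λ a → a ∈ Y × P a) (someNot : ∃ λ b → b ∈ Y × ¬ P b) where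

    cut : Bipartition Y
    cut = bipartition (λ x → does (P? x)) inhabitedCut
      where
        inhabitedCut : ∀ s → ∃ λ a → a ∈ Y × does (P? a) ≡ s
        inhabitedCut true  = let a , a∈ , pa = some in a , a∈ , dec-true (P? a) pa
        inhabitedCut false = let b , b∈ , ¬pb = someNot in b , b∈ , dec-false (P? b) ¬pb

    cutParallel : (∀ {a b} → a ∈ Y → b ∈ Y → P a → ¬ P b → ¬ a ≺ b × ¬ b ≺ a) → Split Y
    cutParallel apart = parallel cut separated
      where
        separated : Parallel Y cut
        separated {a} {b} a∈ b∈ differ with P? a | P? b
        ... | yes pa | no ¬pb = proj₁ (apart a∈ b∈ pa ¬pb)
        ... | no ¬pa | yes pb = proj₂ (apart b∈ a∈ pb ¬pa)
        ... | yes _  | yes _  = contradiction refl differ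
        ... | no _   | no _   = contradiction refl differ

    cutSeries : (∀ {a b} → a ∈ Y → b ∈ Y → P a → ¬ P b → a ≺ b) → Split Y
    cutSeries below = series cut λ {a} {b} a∈ b∈ lower upper → below a∈ b∈ (holds (P? a) lower) (fails (P? b) upper)

  open Cut using (cutParallel; cutSeries)

  -- Elements of Y ∖ m are below m or beside
  -- (incomparable with) m, and the case analysis looks at the pairs below × beside.
  module Step (Y : List A) (m : A) (m∈ : m ∈ Y) (m-max : Maximal Y m) where

    Y⁻ : List A
    Y⁻ = filter (λ x → ¬? (x ≟ m)) Y

    ∈-Y⁻ : ∀ {x} → x ∈ Y → x ≢ m → x ∈ Y⁻
    ∈-Y⁻ = ∈-filter⁺ (λ x → ¬? (x ≟ m))

    Y⁻-⊆ : ∀ {x} → x ∈ Y⁻ → x ∈ Y × x ≢ m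
    Y⁻-⊆ = ∈-filter⁻ (λ x → ¬? (x ≟ m))

    Y⁻-shorter : length Y⁻ < length Y
    Y⁻-shorter = filter-notAll (λ x → ¬? (x ≟ m)) Y (lose m∈ λ m≢m → m≢m refl)

    -- x is incomparable with m (m ≺ x being excluded by maximality).
    Beside : A → Set
    Beside x = x ≢ m × ¬ x ≺ m

    beside? : ∀ x → Dec (Beside x)
    beside? x = ¬? (x ≟ m) ×-dec ¬? (x ≺? m)

    notBeside : ∀ {x} → ¬ Beside x → x ≡ m ⊎ x ≺ m
    notBeside {x} ¬beside with x ≟ m
    ... | yes x≡m = inj₁ x≡m
    ... | no x≢m  = inj₂ (decidable-stable (x ≺? m) λ x⊀m → ¬beside (x≢m , x⊀m))

    Link Gap : A → A → Set
    Link d e = d ≺ m × Beside e × d ≺ e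
    Gap  d e = d ≺ m × Beside e × ¬ d ≺ e

    link? : ∀ d e → Dec (Link d e)
    link? d e = (d ≺? m) ×-dec beside? e ×-dec (d ≺? e)

    gap? : ∀ d e → Dec (Gap d e)
    gap?  d e = (d ≺? m) ×-dec beside? e ×-dec ¬? (d ≺? e)

    -- Nothing beside m: Y ∖ m lies below m.
    allBelow : (∃ λ a → a ∈ Y × a ≢ m) → (∀ {x} → x ∈ Y → ¬ Beside x) → Split Y
    allBelow other noneBeside = cutSeries (λ x → ¬? (x ≟ m)) other (m , m∈ , λ m≢m → m≢m refl) below
      where
        below : ∀ {a b} → a ∈ Y → b ∈ Y → a ≢ m → ¬ b ≢ m → a ≺ b
        below {a} {b} a∈ _ a≢m ¬b≢m with notBeside (noneBeside a∈)
        ... | inj₁ a≡m = contradiction a≡m a≢m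
        ... | inj₂ a≺m = subst (a ≺_) (sym (decidable-stable (b ≟ m) ¬b≢m)) a≺m

    -- No links: the elements beside m are parallel to the rest.
    besideApart : (∃ λ e → e ∈ Y × Beside e) → (∀ {d e} → d ∈ Y → e ∈ Y → ¬ Link d e) → Split Y
    besideApart someBeside noLink = cutParallel beside? someBeside (m , m∈ , λ beside → proj₁ beside refl) apart
      where
        apart : ∀ {a b} → a ∈ Y → b ∈ Y → Beside a → ¬ Beside b → ¬ a ≺ b × ¬ b ≺ a
        apart a∈ b∈ (a≢m , a⊀m) ¬beside with notBeside ¬beside
        ... | inj₁ refl = a⊀m , m-max a∈
        ... | inj₂ b≺m  = (λ a≺b → a⊀m (≺-trans a≺b b≺m)) , λ b≺a → noLink b∈ a∈ (b≺m , (a≢m , a⊀m) , b≺a)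

    -- No gaps: the elements below m lie below everything else.
    belowFirst : (∃ λ d → d ∈ Y × d ≺ m) → (∀ {d e} → d ∈ Y → e ∈ Y → ¬ Gap d e) → Split Y
    belowFirst someBelow noGap = cutSeries (_≺? m) someBelow (m , m∈ , irrefl) below
      where
        below : ∀ {a b} → a ∈ Y → b ∈ Y → a ≺ m → ¬ b ≺ m → a ≺ b
        below {a} {b} a∈ b∈ a≺m b⊀m with b ≟ m
        ... | yes refl = a≺m
        ... | no b≢m   = decidable-stable (a ≺? b) λ a⊀b → noGap a∈ b∈ (a≺m , (b≢m , b⊀m) , a⊀b)

    relabel : Bool → (A → Bool) → A → Bool
    relabel s f x = if does (x ≟ m) then s else f x

    relabel-off : ∀ {s f x} → x ≢ m → relabel s f x ≡ f x
    relabel-off {x = x} x≢m with x ≟ m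
    ... | yes x≡m = contradiction x≡m x≢m
    ... | no _    = refl

    extend : Bipartition Y⁻ → Bool → Bipartition Y
    extend β s = bipartition (relabel s (block β)) inhabitedExtension
      where
        inhabitedExtension : ∀ s′ → ∃ λ a → a ∈ Y × relabel s (block β) a ≡ s′
        inhabitedExtension s′ =
          let a , a∈ , βa = inhabited β s′ ; a∈Y , a≢m = Y⁻-⊆ a∈
          in a , a∈Y , trans (relabel-off {s} {block β} a≢m) βa

    extendParallel : (β : Bipartition Y⁻) → Parallel Y⁻ β → (s : Bool) →
                     (∀ {w} → w ∈ Y⁻ → block β w ≢ s → ¬ w ≺ m) → Split Y
    extendParallel β par s unreached = parallel (extend β s) separated
      where
        separated : Parallel Y (extend β s)
        separated {a} {b} a∈ b∈ differ with a ≟ m | b ≟ m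
        ... | yes refl | yes refl = contradiction refl differ
        ... | yes refl | no _     = m-max b∈
        ... | no a≢m   | yes refl = unreached (∈-Y⁻ a∈ a≢m) differ
        ... | no a≢m   | no b≢m   = par (∈-Y⁻ a∈ a≢m) (∈-Y⁻ b∈ b≢m) differ

    extendSeries : (β : Bipartition Y⁻) → Series Y⁻ β →
                   (∀ {a} → a ∈ Y⁻ → block β a ≡ true → a ≺ m) → Split Y
    extendSeries β ser lowerBelow = series (extend β false) ordered
      where
        ordered : Series Y (extend β false)
        ordered {a} {b} a∈ b∈ lower upper with a ≟ m | b ≟ m
        ... | yes refl | _        = contradiction lower λ ()
        ... | no a≢m   | yes refl = lowerBelow (∈-Y⁻ a∈ a≢m) lower
        ... | no a≢m   | no b≢m   = ser (∈-Y⁻ a∈ a≢m) (∈-Y⁻ b∈ b≢m) lower upper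

    -- Given a link d ≺ e: in a parallel split of Y ∖ m every predecessor w of m lies in the block
    -- of d, since trifunctionality yields w ≺ e, d ≺ w or e ≺ m; so m joins that block.
    joinParallel : ∀ {d e} → d ∈ Y → e ∈ Y → Link d e → (β : Bipartition Y⁻) → Parallel Y⁻ β → Split Y
    joinParallel {d} {e} d∈ e∈ (d≺m , (e≢m , e⊀m) , d≺e) β par = extendParallel β par (block β d) unreached
      where
        d⁻ = ∈-Y⁻ d∈ (≺⇒≢ d≺m)
        e⁻ = ∈-Y⁻ e∈ e≢m

        sameBlock : block β e ≡ block β d
        sameBlock = decidable-stable (block β e ≟ᵇ block β d) λ differ → par d⁻ e⁻ (differ ∘ sym) d≺e

        unreached : ∀ {w} → w ∈ Y⁻ → block β w ≢ block β d → ¬ w ≺ m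
        unreached w∈ differ w≺m with trifun w≺m d≺m d≺e
        ... | inj₁ w≺e        = par w∈ e⁻ (λ same → differ (trans same sameBlock)) w≺e
        ... | inj₂ (inj₁ d≺w) = par d⁻ w∈ (differ ∘ sym) d≺w
        ... | inj₂ (inj₂ e≺m) = e⊀m e≺m

    -- Given a gap d ⊀ e: in a series split of Y ∖ m, d is in the upper block (otherwise
    -- trifunctionality with an upper element b yields e ≺ m, d ≺ e or m ≺ b); so the lower
    -- block lies below d ≺ m and m joins the upper block.
    joinSeries : ∀ {d e} → d ∈ Y → e ∈ Y → Gap d e → (β : Bipartition Y⁻) → Series Y⁻ β → Split Y
    joinSeries {d} {e} d∈ e∈ (d≺m , (e≢m , e⊀m) , d⊀e) β ser =
      extendSeries β ser λ a∈ lower → ≺-trans (ser a∈ d⁻ lower dUpper) d≺m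
      where
        d⁻ = ∈-Y⁻ d∈ (≺⇒≢ d≺m)
        e⁻ = ∈-Y⁻ e∈ e≢m

        dNotLower : block β d ≢ true
        dNotLower dLower with block β e in eBlock
        ... | false = d⊀e (ser d⁻ e⁻ dLower eBlock)
        ... | true with inhabited β false
        ...   | b , b∈ , bUpper with trifun (ser e⁻ b∈ eBlock bUpper) (ser d⁻ b∈ dLower bUpper) d≺m
        ...     | inj₁ e≺m        = e⊀m e≺m
        ...     | inj₂ (inj₁ d≺e) = d⊀e d≺e
        ...     | inj₂ (inj₂ m≺b) = m-max (proj₁ (Y⁻-⊆ b∈)) m≺b

        dUpper : block β d ≡ false
        dUpper = ¬-not dNotLower

    otherThanM : ∀ {u v} → u ∈ Y → v ∈ Y → u ≢ v → ∃ λ a → a ∈ Y × a ≢ m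
    otherThanM {u} u∈ v∈ u≢v with u ≟ m
    ... | yes refl = -, v∈ , λ v≡m → u≢v (sym v≡m)
    ... | no u≢m   = -, u∈ , u≢m

    step : (∀ {u v} → u ∈ Y⁻ → v ∈ Y⁻ → u ≢ v → Split Y⁻) → ∀ {u v} → u ∈ Y → v ∈ Y → u ≢ v → Split Y
    step splitY⁻ u∈ v∈ u≢v with search beside? Y
    ... | inj₂ noneBeside = allBelow (otherThanM u∈ v∈ u≢v) noneBeside
    ... | inj₁ someBeside with searchPairs link? Y
    ...   | inj₂ noLink = besideApart someBeside noLink
    ...   | inj₁ (d₁ , e₁ , d₁∈ , e₁∈ , link₁@(d₁≺m , (e₁≢m , _) , d₁≺e₁)) with searchPairs gap? Y
    ...     | inj₂ noGap = belowFirst (d₁ , d₁∈ , d₁≺m) noGap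
    ...     | inj₁ (d₂ , e₂ , d₂∈ , e₂∈ , gap₂) with splitY⁻ (∈-Y⁻ d₁∈ (≺⇒≢ d₁≺m)) (∈-Y⁻ e₁∈ e₁≢m) (≺⇒≢ d₁≺e₁)
    ...       | parallel β par = joinParallel d₁∈ e₁∈ link₁ β par
    ...       | series β ser   = joinSeries d₂∈ e₂∈ gap₂ β ser

  split : ∀ n {Y u v} → length Y ≤ n → u ∈ Y → v ∈ Y → u ≢ v → Split Y
  split n       {[]}     _  ()
  split zero    {_ ∷ _}  ()
  split (suc n) {y ∷ ys} len u∈ v∈ u≢v with maximal y ys
  ... | m , m∈ , m-max = step (split n (shorter Y⁻-shorter len)) u∈ v∈ u≢v
    where open Step (y ∷ ys) m m∈ m-max

module Decomposition {_≺_ : Var → Var → Set} (_≺?_ : ∀ x y → Dec (x ≺ y))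
                     (irrefl : ∀ {x} → ¬ x ≺ x)
                     (≺-trans : ∀ {x y z} → x ≺ y → y ≺ z → x ≺ z)
                     (trifun : Trifunctional _≺_) where
  open Splitting _≟ℕ_ _≺?_ irrefl ≺-trans trifun

  record Represents (Y : List Var) (t : Term) : Set where
    field
      diversified : Diversified t
      domain      : ∀ x → (x ∈ vars t) ⇔ (x ∈ Y)
      relation    : ∀ a b → κRel t a b ⇔ (a ≺ b × a ∈ Y × b ∈ Y)
  open Represents

  point : ∀ {Y y} → y ∈ Y → (∀ {x} → x ∈ Y → x ≡ y) → Represents Y (var y)
  point y∈ onlyY = record
    { diversified = [] ∷ []
    ; domain      = λ x → mk⇔ (λ { (here refl) → y∈ }) (here ∘ onlyY)
    ; relation    = λ a b → mk⇔ (λ ()) λ (a≺b , a∈ , b∈) → irrefl (subst₂ _≺_ (onlyY a∈) (onlyY b∈) a≺b)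
    }

  ShorterRepresented : List Var → Set
  ShorterRepresented Y = ∀ {Y′} → length Y′ < length Y → ∀ {y} → y ∈ Y′ → ∃ (Represents Y′)

  module Combine {Y : List Var} (β : Bipartition Y) (rec : ShorterRepresented Y) where

    part : Bool → List Var
    part s = filter (λ x → block β x ≟ᵇ s) Y

    ∈-part : ∀ {s x} → x ∈ Y → block β x ≡ s → x ∈ part s
    ∈-part {s} = ∈-filter⁺ (λ x → block β x ≟ᵇ s)

    part-⊆ : ∀ {s x} → x ∈ part s → x ∈ Y × block β x ≡ s
    part-⊆ {s} = ∈-filter⁻ (λ x → block β x ≟ᵇ s)

    -- A block misses the elements of the other block, hence is shorter than Y.
    part-shorter : ∀ s → length (part s) < length Y
    part-shorter s =
      let b , b∈ , βb = inhabited β (not s)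
      in filter-notAll (λ x → block β x ≟ᵇ s) Y (lose b∈ λ βb≡s → not-¬ βb≡s βb)

    represented : ∀ s → ∃ (Represents (part s))
    represented s = let a , a∈ , βa = inhabited β s in rec (part-shorter s) (∈-part a∈ βa)

    t : Bool → Term
    t s = proj₁ (represented s)

    rep : ∀ s → Represents (part s) (t s)
    rep s = proj₂ (represented s)

    varsIn : ∀ {s x} → x ∈ vars (t s) → x ∈ Y × block β x ≡ s
    varsIn {s} {x} x∈ = part-⊆ (Equivalence.to (domain (rep s) x) x∈)

    inner : ∀ {s a b} → κRel (t s) a b → a ≺ b × a ∈ Y × b ∈ Y
    inner {s} {a} {b} κab =
      let a≺b , a∈ , b∈ = Equivalence.to (relation (rep s) a b) κab
      in a≺b , proj₁ (part-⊆ a∈) , proj₁ (part-⊆ b∈)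

    within : ∀ {s a b} → a ≺ b → a ∈ Y → b ∈ Y → block β a ≡ s → block β b ≡ s → κRel (t s) a b
    within {s} {a} {b} a≺b a∈ b∈ βa βb = Equivalence.from (relation (rep s) a b) (a≺b , ∈-part a∈ βa , ∈-part b∈ βb)

    unique : Diversified (t true ⊕ t false)
    unique = ++⁺ (diversified (rep true)) (diversified (rep false))
                 λ (x∈₁ , x∈₂) → contradiction (trans (sym (proj₂ (varsIn x∈₁))) (proj₂ (varsIn x∈₂))) λ ()

    varsAll : ∀ x → (x ∈ vars (t true) ++ vars (t false)) ⇔ (x ∈ Y)
    varsAll x = mk⇔ to from
      where
        to : x ∈ vars (t true) ++ vars (t false) → x ∈ Y
        to x∈ with ∈-++⁻ (vars (t true)) x∈
        ... | inj₁ x∈₁ = proj₁ (varsIn x∈₁)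
        ... | inj₂ x∈₂ = proj₁ (varsIn x∈₂)
        from : x ∈ Y → x ∈ vars (t true) ++ vars (t false)
        from x∈ with block β x in βx
        ... | true  = ∈-++⁺ˡ (Equivalence.from (domain (rep true) x) (∈-part x∈ βx))
        ... | false = ∈-++⁺ʳ (vars (t true)) (Equivalence.from (domain (rep false) x) (∈-part x∈ βx))

    sum : Parallel Y β → Represents Y (t true ⊕ t false)
    sum par = record { diversified = unique ; domain = varsAll ; relation = λ a b → mk⇔ to from }
      where
        to : ∀ {a b} → κRel (t true ⊕ t false) a b → a ≺ b × a ∈ Y × b ∈ Y
        to (inj₁ κab) = inner κab
        to (inj₂ κab) = inner κab
        from : ∀ {a b} → a ≺ b × a ∈ Y × b ∈ Y → κRel (t true ⊕ t false) a b
        from {a} {b} (a≺b , a∈ , b∈) with block β a in βa | block β b in βb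
        ... | true  | true  = inj₁ (within a≺b a∈ b∈ βa βb)
        ... | false | false = inj₂ (within a≺b a∈ b∈ βa βb)
        ... | true  | false = contradiction a≺b (par a∈ b∈ (subst₂ _≢_ (sym βa) (sym βb) λ ()))
        ... | false | true  = contradiction a≺b (par a∈ b∈ (subst₂ _≢_ (sym βa) (sym βb) λ ()))

    product : Series Y β → Represents Y (t true ⊙ t false)
    product ser = record { diversified = unique ; domain = varsAll ; relation = λ a b → mk⇔ to from }
      where
        to : ∀ {a b} → κRel (t true ⊙ t false) a b → a ≺ b × a ∈ Y × b ∈ Y
        to (inj₁ κab)                 = inner κab
        to (inj₂ (inj₁ κab))          = inner κab
        to (inj₂ (inj₂ (a∈₁ , b∈₂))) =
          let a∈ , βa = varsIn a∈₁ ; b∈ , βb = varsIn b∈₂ in ser a∈ b∈ βa βb , a∈ , b∈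
        from : ∀ {a b} → a ≺ b × a ∈ Y × b ∈ Y → κRel (t true ⊙ t false) a b
        from {a} {b} (a≺b , a∈ , b∈) with block β a in βa | block β b in βb
        ... | true  | true  = inj₁ (within a≺b a∈ b∈ βa βb)
        ... | false | false = inj₂ (inj₁ (within a≺b a∈ b∈ βa βb))
        ... | true  | false = inj₂ (inj₂ ( Equivalence.from (domain (rep true) a) (∈-part a∈ βa)
                                         , Equivalence.from (domain (rep false) b) (∈-part b∈ βb)))
        ... | false | true  = contradiction (≺-trans a≺b (ser b∈ a∈ βb βa)) irrefl

  combine : ∀ {Y} → Split Y → ShorterRepresented Y → ∃ (Represents Y)
  combine (parallel β par) rec = -, Combine.sum β rec par
  combine (series β ser)   rec = -, Combine.product β rec ser

  decompose : ∀ n {Y y} → length Y ≤ n → y ∈ Y → ∃ (Represents Y)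
  decompose zero    {[]}    _ ()
  decompose zero    {_ ∷ _} ()
  decompose (suc n) {Y} {y} len y∈ with search (λ x → ¬? (x ≟ℕ y)) Y
  ... | inj₂ onlyY          = var y , point y∈ λ x∈ → decidable-stable (_ ≟ℕ y) (onlyY x∈)
  ... | inj₁ (z , z∈ , z≢y) = combine (split (length Y) ≤-refl z∈ y∈ z≢y)
                                      λ shorterY → decompose n (shorter shorterY len)

related? : (ρ : FinRel) → ∀ a b → Dec (a ~[ ρ ] b)
related? ρ a b = DecMembership._∈?_ (≡-dec _≟ℕ_ _≟ℕ_) (a , b) (R ρ)

-- Related pairs lie in the domain, so the trifunctional law of an FTP relation holds for all variables.
ftp-trifunctional : ∀ {ρ} → InFTP ρ → Trifunctional (_~[ ρ ]_)
ftp-trifunctional F x≺z y≺z y≺u =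
  trifunctional _ _ _ _ (proj₁ (relOn _ _ x≺z)) (proj₁ (relOn _ _ y≺z)) (proj₂ (relOn _ _ x≺z)) (proj₂ (relOn _ _ y≺u))
                x≺z y≺z y≺u
  where open InFTP F

proposition3p3 : (ρ : FinRel) → InFTP ρ → ∃ λ t → Diversified t × κ≡ t ρ
proposition3p3 ρ F =
  let y , y∈  = nonempty
      t , rep = decompose (length (X ρ)) ≤-refl y∈
  in t , diversified rep , domain rep ,
     λ a b → mk⇔ (proj₁ ∘ Equivalence.to (relation rep a b))
                 (λ a≺b → Equivalence.from (relation rep a b) (a≺b , relOn a b a≺b))
  where
    open InFTP F
    open Decomposition (related? ρ) (λ {x} → irreflexive x) (λ {x} {y} {z} → transitive x y z) (ftp-trifunctional F)
    open Represents
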